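{- Let $p$ be an odd prime and let $a,q,n$ be non-negative integers. Then $$\sum_{r=0}^{a}\frac{\big((r+q)p+n\big)!}{(r+q)!\,p^{\,r+q}}\binom{a}{r}\equiv 0 \pmod{p^M},$$ where $$M=\begin{cases}\operatorname{ord}_p(n!) & \text{if } n\ge ap,\\[2pt] a-\lfloor n/p\rfloor+\operatorname{ord}_p(n!)-\big\lfloor (a-\lfloor n/p\rfloor)/p\big\rfloor & \text{if } n<ap.\end{cases}$$
   Context: $\operatorname{ord}_p(m)$ denotes the $p$-adic valuation of a nonzero integer $m$, and $\lfloor x\rfloor$ the greatest integer not exceeding $x$. Each summand $\frac{((r+q)p+n)!}{(r+q)!p^{r+q}}$ is an integer. -}

module Defs where

open import Data.Nat using (ℕ; zero; suc; _+_; _*_; _∸_; _^_; _!; _<_; _≤_; _≤?_; NonZero)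
open import Data.Nat.Properties using (m*n≢0; m^n≢0; _!≢0)
open import Data.Nat.DivMod using (_/_)
open import Data.Nat.Divisibility using (_∣_)
open import Data.Nat.Combinatorics using (_C_)
open import Data.Product using (_×_)
open import Relation.Nullary using (¬_; yes; no)

IsOrd : ℕ → ℕ → ℕ → Set
IsOrd p m k = (p ^ k ∣ m) × ¬ (p ^ suc k ∣ m)

-- The summand ((r+q)p+n)! / ((r+q)! p^(r+q))  (exact division; it is an integer).
summand : (p q n r : ℕ) → .{{NonZero p}} → ℕ
summand p q n r =
  ((r + q) * p + n) ! / ((r + q) ! * p ^ (r + q))
  where instance
    nz : NonZero ((r + q) ! * p ^ (r + q))
    nz = m*n≢0 _ _ {{(r + q) !≢0}} {{m^n≢0 p (r + q)}}

sumTo : ℕ → (ℕ → ℕ) → ℕ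
sumTo zero    f = f 0
sumTo (suc a) f = sumTo a f + f (suc a)

S : (p a q n : ℕ) → .{{NonZero p}} → ℕ
S p a q n = sumTo a (λ r → summand p q n r * (a C r))

-- The exponent M, given o = ord_p(n!)
M : (p a n o : ℕ) → .{{NonZero p}} → ℕ
M p a n o with a * p ≤? n
... | yes _ = o
... | no  _ = ((a ∸ (n / p)) + o) ∸ ((a ∸ (n / p)) / p)

-- Write n = mp + s with 0 ≤ s < p, and let h(x) = x − ⌊x/p⌋ (nonMultiples p x). Cutting
-- ((r+q)p+n)! into blocks of p consecutive integers shows that the r-th summand equals
-- n! · C(r+q+m, m) · V(r+q), where V(k) = W(0)⋯W(k−1) and W(k) is the product of the p − 1
-- units of the k-th block. Hence S = n! · (T^a B)(q) · V(q), with B(k) = C(k+m, m) and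
-- (T F)(k) = F(k) + W(k) F(k+1).
--
-- W(k) is congruent to (kp+1)⋯(kp+p−1) = Σ_l s(p−1,l) (kp)^l, and by Wilson's theorem and the
-- vanishing modulo p of the middle Stirling numbers s(p−1,l), the i-th finite differences of
-- 1 + W are divisible by p^h(i+1). Writing T F = −ΔF + (1+W)·F(·+1), the Leibniz rule for
-- differences and the subadditivity of h show that each application of T trades one
-- difference for one more power of p; since the i-th differences of B are divisible by
-- p^h(i−m), the value (T^a B)(q) is divisible by p^h(a−m). Finally M ≤ ord_p(n!) + h(a − m).

module Submission where

open import Defs
open import Data.Nat using (ℕ; _^_; _!)
open import Data.Nat.Divisibility using (_∣_)
open import Data.Nat.Primality using (Prime; prime⇒nonZero)
open import Relation.Nullary using (¬_)

module Arithmetic where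

  open import Data.Nat using (zero; suc; _+_; _*_; _∸_; _^_; _≤_)
  open import Data.Nat.Properties
  open import Data.Nat.Divisibility using (_∣_; divides)
  open import Data.Nat.Tactic.RingSolver using (solve-∀)
  open import Relation.Binary.PropositionalEquality

  ^-monoʳ-∣ : ∀ p {m n} → m ≤ n → p ^ m ∣ p ^ n
  ^-monoʳ-∣ p {m} {n} m≤n = divides (p ^ (n ∸ m)) (begin
    p ^ n                 ≡⟨ cong (p ^_) (sym (m+[n∸m]≡n m≤n)) ⟩
    p ^ (m + (n ∸ m))     ≡⟨ ^-distribˡ-+-* p m (n ∸ m) ⟩
    p ^ m * p ^ (n ∸ m)   ≡⟨ *-comm (p ^ m) _ ⟩
    p ^ (n ∸ m) * p ^ m   ∎)
    where open ≡-Reasoning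

  ^-∣-* : ∀ p {m} n o → m ≤ n + o → p ^ m ∣ p ^ n * p ^ o
  ^-∣-* p n o m≤n+o = subst (_ ∣_) (^-distribˡ-+-* p n o) (^-monoʳ-∣ p m≤n+o)

  +-∸-≤ : ∀ a b m → a + b ∸ m ≤ a + (b ∸ m)
  +-∸-≤ a b m = m≤n+o⇒m∸n≤o (a + b) m (begin
    a + b             ≤⟨ +-monoʳ-≤ a (m≤n+m∸n b m) ⟩
    a + (m + (b ∸ m)) ≡⟨ x+[y+z]≡y+[x+z] a m (b ∸ m) ⟩
    m + (a + (b ∸ m)) ∎)
    where
      open ≤-Reasoning
      x+[y+z]≡y+[x+z] : ∀ x y z → x + (y + z) ≡ y + (x + z)
      x+[y+z]≡y+[x+z] = solve-∀

  *-^ : ∀ a b l → (a * b) ^ l ≡ a ^ l * b ^ l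
  *-^ a b zero    = refl
  *-^ a b (suc l) = trans (cong (a * b *_) (*-^ a b l)) (interchange a b (a ^ l) (b ^ l))
    where interchange : ∀ a b c d → a * b * (c * d) ≡ a * c * (b * d)
          interchange = solve-∀

module SumTo where

  open import Data.Nat using (ℕ; zero; suc; _+_; _*_; _≤_; _<_; z≤n; s≤s)
  open import Data.Nat.Properties
  open import Data.Nat.Divisibility using (_∣_; ∣m∣n⇒∣m+n)
  open import Data.Nat.Tactic.RingSolver using (solve-∀)
  open import Relation.Binary.PropositionalEquality

  sumTo-cong : ∀ n {f g : ℕ → ℕ} → (∀ j → j ≤ n → f j ≡ g j) → sumTo n f ≡ sumTo n g
  sumTo-cong zero    f≡g = f≡g 0 z≤n
  sumTo-cong (suc n) f≡g = cong₂ _+_ (sumTo-cong n (λ j j≤n → f≡g j (m≤n⇒m≤1+n j≤n))) (f≡g (suc n) ≤-refl)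

  sumTo-suc : ∀ n (f : ℕ → ℕ) → sumTo (suc n) f ≡ f 0 + sumTo n (λ j → f (suc j))
  sumTo-suc zero    f = refl
  sumTo-suc (suc n) f = trans (cong (_+ f (suc (suc n))) (sumTo-suc n f)) (+-assoc (f 0) _ _)

  sumTo-+ : ∀ n (f g : ℕ → ℕ) → sumTo n (λ j → f j + g j) ≡ sumTo n f + sumTo n g
  sumTo-+ zero    f g = refl
  sumTo-+ (suc n) f g = trans (cong (_+ (f (suc n) + g (suc n))) (sumTo-+ n f g))
                              (interchange (sumTo n f) (sumTo n g) (f (suc n)) (g (suc n)))
    where interchange : ∀ a b c d → a + b + (c + d) ≡ a + c + (b + d)
          interchange = solve-∀

  sumTo-*ʳ : ∀ n (f : ℕ → ℕ) c → sumTo n (λ j → f j * c) ≡ sumTo n f * c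
  sumTo-*ʳ zero    f c = refl
  sumTo-*ʳ (suc n) f c = trans (cong (_+ f (suc n) * c) (sumTo-*ʳ n f c)) (sym (*-distribʳ-+ c (sumTo n f) _))

  sumTo-*ˡ : ∀ n (f : ℕ → ℕ) c → sumTo n (λ j → c * f j) ≡ c * sumTo n f
  sumTo-*ˡ n f c = trans (sumTo-cong n (λ j _ → *-comm c (f j))) (trans (sumTo-*ʳ n f c) (*-comm _ c))

  sumTo-split : ∀ n d (f : ℕ → ℕ) → sumTo (n + suc d) f ≡ sumTo n f + sumTo d (λ j → f (suc n + j))
  sumTo-split n zero    f = trans (cong (λ z → sumTo z f) (+-comm n 1)) (cong (λ z → sumTo n f + f z) (sym (+-identityʳ (suc n))))
  sumTo-split n (suc d) f = begin
    sumTo (n + suc (suc d)) f                                   ≡⟨ cong (λ z → sumTo z f) (+-suc n (suc d)) ⟩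
    sumTo (n + suc d) f + f (suc (n + suc d))                   ≡⟨ cong (_+ f (suc n + suc d)) (sumTo-split n d f) ⟩
    sumTo n f + sumTo d (λ j → f (suc n + j)) + f (suc n + suc d) ≡⟨ +-assoc (sumTo n f) _ _ ⟩
    sumTo n f + sumTo (suc d) (λ j → f (suc n + j))             ∎
    where open ≡-Reasoning

  sumTo-zero : ∀ n (f : ℕ → ℕ) → (∀ j → j ≤ n → f j ≡ 0) → sumTo n f ≡ 0
  sumTo-zero n f f≡0 = trans (sumTo-cong n f≡0) (zeros n)
    where zeros : ∀ n → sumTo n (λ _ → 0) ≡ 0
          zeros zero    = refl
          zeros (suc n) = trans (+-identityʳ _) (zeros n)

  ∣-sumTo : ∀ {d} n (f : ℕ → ℕ) → (∀ j → j ≤ n → d ∣ f j) → d ∣ sumTo n f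
  ∣-sumTo zero    f d∣f = d∣f 0 z≤n
  ∣-sumTo (suc n) f d∣f = ∣m∣n⇒∣m+n (∣-sumTo n f (λ j j≤n → d∣f j (m≤n⇒m≤1+n j≤n))) (d∣f (suc n) ≤-refl)

  sumTo-peel : ∀ n (f : ℕ → ℕ) → f (suc n) ≡ 0 → sumTo n f ≡ f 0 + sumTo n (λ j → f (suc j))
  sumTo-peel n f last≡0 = begin
    sumTo n f              ≡⟨ sym (+-identityʳ _) ⟩
    sumTo n f + 0          ≡⟨ cong (sumTo n f +_) (sym last≡0) ⟩
    sumTo (suc n) f        ≡⟨ sumTo-suc n f ⟩
    f 0 + sumTo n (λ j → f (suc j)) ∎
    where open ≡-Reasoning

  sumTo-last : ∀ n (f : ℕ → ℕ) → (∀ j → j < n → f j ≡ 0) → sumTo n f ≡ f n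
  sumTo-last zero    f _      = refl
  sumTo-last (suc n) f low≡0 = cong (_+ f (suc n)) (sumTo-zero n f (λ j j≤n → low≡0 j (s≤s j≤n)))

module NonMultiples where

  open import Data.Nat using (ℕ; suc; _+_; _*_; _∸_; _/_; _≤_; NonZero)
  open import Data.Nat.Properties
  open import Data.Nat.DivMod using (m/n≤m; /-monoˡ-≤; +-distrib-/-∣ʳ; +-distrib-/-∣ˡ; m*n/n≡m; m/n*n≤m; m≥n⇒m/n>0)
  open import Data.Nat.Divisibility using (n∣m*n)
  open import Data.Nat.Tactic.RingSolver using (solve-∀)
  open import Relation.Binary.PropositionalEquality

  module _ (p : ℕ) .{{_ : NonZero p}} where

    nonMultiples : ℕ → ℕ
    nonMultiples x = x ∸ x / p

    nonMultiples+quotient : ∀ x → nonMultiples x + x / p ≡ x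
    nonMultiples+quotient x = m∸n+n≡m (m/n≤m x p)

    nonMultiples-zero : nonMultiples 0 ≡ 0
    nonMultiples-zero = 0∸n≡0 (0 / p)

    nonMultiples-≤ : ∀ x → nonMultiples x ≤ x
    nonMultiples-≤ x = m∸n≤m x (x / p)

    nonMultiples-≤-pred : ∀ {i} → p ≤ suc i → nonMultiples (suc i) ≤ i
    nonMultiples-≤-pred p≤1+i = ∸-monoʳ-≤ (suc _) (m≥n⇒m/n>0 p≤1+i)

    /-+-≤ : ∀ x d → (x + d) / p ≤ x / p + d
    /-+-≤ x d = begin
      (x + d) / p     ≤⟨ /-monoˡ-≤ p (+-monoʳ-≤ x (m≤m*n d p)) ⟩
      (x + d * p) / p ≡⟨ +-distrib-/-∣ʳ x (n∣m*n d) ⟩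
      x / p + d * p / p ≡⟨ cong (x / p +_) (m*n/n≡m d p) ⟩
      x / p + d       ∎
      where open ≤-Reasoning

    /-superadditive : ∀ x y → x / p + y / p ≤ (x + y) / p
    /-superadditive x y = begin
      x / p + y / p         ≡⟨ cong (_+ y / p) (sym (m*n/n≡m (x / p) p)) ⟩
      x / p * p / p + y / p ≡⟨ sym (+-distrib-/-∣ˡ y (n∣m*n (x / p))) ⟩
      (x / p * p + y) / p   ≤⟨ /-monoˡ-≤ p (+-monoˡ-≤ y (m/n*n≤m x p)) ⟩
      (x + y) / p           ∎
      where open ≤-Reasoning

    nonMultiples-mono : ∀ {x y} → x ≤ y → nonMultiples x ≤ nonMultiples y
    nonMultiples-mono {x} {y} x≤y = +-cancelʳ-≤ (x / p + d) (nonMultiples x) (nonMultiples y) (begin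
      nonMultiples x + (x / p + d) ≡⟨ sym (+-assoc (nonMultiples x) (x / p) d) ⟩
      nonMultiples x + x / p + d   ≡⟨ cong (_+ d) (nonMultiples+quotient x) ⟩
      x + d                        ≡⟨ sym (nonMultiples+quotient (x + d)) ⟩
      nonMultiples (x + d) + (x + d) / p ≤⟨ +-monoʳ-≤ (nonMultiples (x + d)) (/-+-≤ x d) ⟩
      nonMultiples (x + d) + (x / p + d) ≡⟨ cong (λ z → nonMultiples z + (x / p + d)) (m+[n∸m]≡n x≤y) ⟩
      nonMultiples y + (x / p + d) ∎)
      where
        open ≤-Reasoning
        d = y ∸ x

    nonMultiples-subadditive : ∀ x y → nonMultiples (x + y) ≤ nonMultiples x + nonMultiples y
    nonMultiples-subadditive x y =
      +-cancelʳ-≤ ((x + y) / p) (nonMultiples (x + y)) (nonMultiples x + nonMultiples y) (begin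
        nonMultiples (x + y) + (x + y) / p ≡⟨ nonMultiples+quotient (x + y) ⟩
        x + y                              ≡⟨ sym (cong₂ _+_ (nonMultiples+quotient x) (nonMultiples+quotient y)) ⟩
        (nonMultiples x + x / p) + (nonMultiples y + y / p)
          ≡⟨ interchange (nonMultiples x) (x / p) (nonMultiples y) (y / p) ⟩
        (nonMultiples x + nonMultiples y) + (x / p + y / p)
          ≤⟨ +-monoʳ-≤ (nonMultiples x + nonMultiples y) (/-superadditive x y) ⟩
        nonMultiples x + nonMultiples y + (x + y) / p ∎)
      where
        open ≤-Reasoning
        interchange : ∀ a b c d → (a + b) + (c + d) ≡ (a + c) + (b + d)
        interchange = solve-∀

module RisingFactorials where

  open import Data.Nat using (ℕ; zero; suc; _+_; _*_; _!)
  open import Data.Nat.Properties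
  open import Data.Nat.Tactic.RingSolver using (solve-∀)
  open import Relation.Binary.PropositionalEquality

  rising : ℕ → ℕ → ℕ
  rising x zero    = 1
  rising x (suc l) = rising x l * (x + suc l)

  rising-! : ∀ x l → (x + l) ! ≡ x ! * rising x l
  rising-! x zero    = trans (cong _! (+-identityʳ x)) (sym (*-identityʳ _))
  rising-! x (suc l) = begin
    (x + suc l) !                  ≡⟨ cong _! (+-suc x l) ⟩
    suc (x + l) * (x + l) !        ≡⟨ cong (suc (x + l) *_) (rising-! x l) ⟩
    suc (x + l) * (x ! * rising x l) ≡⟨ rearrange (x + l) (x !) (rising x l) ⟩
    x ! * (rising x l * suc (x + l)) ≡⟨ cong (λ z → x ! * (rising x l * z)) (sym (+-suc x l)) ⟩
    x ! * rising x (suc l)         ∎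
    where
      open ≡-Reasoning
      rearrange : ∀ a b c → suc a * (b * c) ≡ b * (c * suc a)
      rearrange = solve-∀

  rising-+ : ∀ x a b → rising x (a + b) ≡ rising x a * rising (x + a) b
  rising-+ x a zero    = trans (cong (rising x) (+-identityʳ a)) (sym (*-identityʳ _))
  rising-+ x a (suc b) = begin
    rising x (a + suc b)                             ≡⟨ cong (rising x) (+-suc a b) ⟩
    rising x (a + b) * (x + suc (a + b))             ≡⟨ cong₂ _*_ (rising-+ x a b) (reassoc x a b) ⟩
    rising x a * rising (x + a) b * (x + a + suc b)  ≡⟨ *-assoc (rising x a) _ _ ⟩
    rising x a * rising (x + a) (suc b)              ∎
    where
      open ≡-Reasoning
      reassoc : ∀ x a b → x + suc (a + b) ≡ x + a + suc b
      reassoc = solve-∀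

module FiniteDifferences where

  open import Data.Nat as ℕ using (ℕ; zero; suc; z≤n)
  import Data.Nat.Properties as ℕ
  open import Data.Integer using (ℤ; +_; 0ℤ; _+_; _-_; -_; _*_)
  open import Data.Integer.Properties using (+-inverseʳ; *-zeroˡ; -1*i≡-i; pos-*; pos-+)
  open import Data.Sum using (inj₁; inj₂)
  open import Data.Nat.Divisibility using (_∣_; _∣0; 1∣_)
  open import Data.Integer.Divisibility.Signed
    using (∣ᵤ⇒∣; ∣-trans; ∣m∣n⇒∣m+n; ∣n⇒∣m*n; *-monoʳ-∣; *-monoˡ-∣)
    renaming (_∣_ to _∣ℤ_)
  open import Data.Integer.Tactic.RingSolver using (solve-∀)
  open import Data.Nat.Combinatorics using (_C_; nCk+nC[k+1]≡[n+1]C[k+1])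
  open import Function using (_∘_)
  open import Relation.Binary.PropositionalEquality

  *-pres-∣ℤ : ∀ {i j m n} → i ∣ℤ m → j ∣ℤ n → i * j ∣ℤ m * n
  *-pres-∣ℤ {j = j} {m} i∣m j∣n = ∣-trans (*-monoˡ-∣ j i∣m) (*-monoʳ-∣ m j∣n)

  ∣-+ : ∀ {d n} → d ∣ n → + d ∣ℤ + n
  ∣-+ = ∣ᵤ⇒∣

  ∣ℤ0 : ∀ d → + d ∣ℤ 0ℤ
  ∣ℤ0 d = ∣ᵤ⇒∣ (d ∣0)

  1∣ℤ_ : ∀ x → + 1 ∣ℤ x
  1∣ℤ x = ∣ᵤ⇒∣ (1∣ _)

  Seq : Set
  Seq = ℕ → ℤ

  Δ : Seq → Seq
  Δ f k = f (suc k) - f k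

  Δ^ : ℕ → Seq → Seq
  Δ^ zero    f = f
  Δ^ (suc i) f = Δ^ i (Δ f)

  Δ^-cong : ∀ i {f g : Seq} → (∀ k → f k ≡ g k) → ∀ k → Δ^ i f k ≡ Δ^ i g k
  Δ^-cong zero    f≡g = f≡g
  Δ^-cong (suc i) f≡g = Δ^-cong i (λ k → cong₂ _-_ (f≡g (suc k)) (f≡g k))

  Δ^-shift : ∀ i (f : Seq) k → Δ^ i (f ∘ suc) k ≡ Δ^ i f (suc k)
  Δ^-shift zero    f k = refl
  Δ^-shift (suc i) f k = Δ^-shift i (Δ f) k

  Δ^-+ : ∀ i (f g : Seq) k → Δ^ i (λ k → f k + g k) k ≡ Δ^ i f k + Δ^ i g k
  Δ^-+ zero    f g k = refl
  Δ^-+ (suc i) f g k = trans (Δ^-cong i (λ k → interchange (f (suc k)) (g (suc k)) (f k) (g k)) k)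
                             (Δ^-+ i (Δ f) (Δ g) k)
    where interchange : ∀ a b c d → (a + b) - (c + d) ≡ (a - c) + (b - d)
          interchange = solve-∀

  Δ^-*ˡ : ∀ i c (f : Seq) k → Δ^ i (λ k → c * f k) k ≡ c * Δ^ i f k
  Δ^-*ˡ zero    c f k = refl
  Δ^-*ˡ (suc i) c f k = trans (Δ^-cong i (λ k → distrib c (f (suc k)) (f k)) k) (Δ^-*ˡ i c (Δ f) k)
    where distrib : ∀ c a b → c * a - c * b ≡ c * (a - b)
          distrib = solve-∀

  Δ^-zero : ∀ i {f : Seq} → (∀ k → f k ≡ 0ℤ) → ∀ k → Δ^ i f k ≡ 0ℤ
  Δ^-zero i {f} f≡0 k = begin
    Δ^ i f k                ≡⟨ Δ^-cong i (λ k → trans (f≡0 k) (sym (*-zeroˡ (f k)))) k ⟩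
    Δ^ i (λ k → 0ℤ * f k) k ≡⟨ Δ^-*ˡ i 0ℤ f k ⟩
    0ℤ * Δ^ i f k           ≡⟨ *-zeroˡ (Δ^ i f k) ⟩
    0ℤ                      ∎
    where open ≡-Reasoning

  Δ^-const : ∀ i c k → Δ^ (suc i) (λ _ → c) k ≡ 0ℤ
  Δ^-const i c = Δ^-zero i (λ _ → +-inverseʳ c)

  Δ^-+-index : ∀ i j (f : Seq) k → Δ^ (i ℕ.+ j) f k ≡ Δ^ j (Δ^ i f) k
  Δ^-+-index zero    j f k = refl
  Δ^-+-index (suc i) j f k = Δ^-+-index i j (Δ f) k

  Δ-* : ∀ (f g : Seq) k → Δ (λ k → f k * g k) k ≡ Δ f k * g (suc k) + f k * Δ g k
  Δ-* f g k = leibniz (f (suc k)) (f k) (g (suc k)) (g k)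
    where leibniz : ∀ a b c d → a * c - b * d ≡ (a - b) * c + b * (c - d)
          leibniz = solve-∀

  Δ^-binomial : ∀ m j k → Δ^ (suc j) (λ k → + ((k ℕ.+ m) C j)) k ≡ 0ℤ
  Δ^-binomial m zero    k = Δ^-const 0 (+ 1) k
  Δ^-binomial m (suc j) k = trans (Δ^-cong (suc j) pascal k) (Δ^-binomial m j k)
    where
      pascal : ∀ k → Δ (λ k → + ((k ℕ.+ m) C suc j)) k ≡ + ((k ℕ.+ m) C j)
      pascal k = begin
        + ((suc k ℕ.+ m) C suc j) - + ((k ℕ.+ m) C suc j)
          ≡⟨ cong (λ x → + x - + ((k ℕ.+ m) C suc j)) (sym (nCk+nC[k+1]≡[n+1]C[k+1] (k ℕ.+ m) j)) ⟩
        + ((k ℕ.+ m) C j ℕ.+ (k ℕ.+ m) C suc j) - + ((k ℕ.+ m) C suc j)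
          ≡⟨ cong (_- + ((k ℕ.+ m) C suc j)) (pos-+ ((k ℕ.+ m) C j) ((k ℕ.+ m) C suc j)) ⟩
        + ((k ℕ.+ m) C j) + + ((k ℕ.+ m) C suc j) - + ((k ℕ.+ m) C suc j)
          ≡⟨ cancel (+ ((k ℕ.+ m) C j)) (+ ((k ℕ.+ m) C suc j)) ⟩
        + ((k ℕ.+ m) C j) ∎
        where
          open ≡-Reasoning
          cancel : ∀ a b → a + b - b ≡ a
          cancel = solve-∀

  shiftedProduct-as-difference : ∀ (F W : ℕ → ℕ) k →
    + (F k ℕ.+ F (suc k) ℕ.* W k) ≡ - Δ (λ k → + F k) k + + (1 ℕ.+ W k) * + F (suc k)
  shiftedProduct-as-difference F W k = begin
    + (F k ℕ.+ F (suc k) ℕ.* W k)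
      ≡⟨ trans (pos-+ (F k) _) (cong (λ z → + F k + z) (pos-* (F (suc k)) (W k))) ⟩
    + F k + + F (suc k) * + W k
      ≡⟨ regroup (+ F k) (+ F (suc k)) (+ W k) ⟩
    - (+ F (suc k) - + F k) + (+ 1 + + W k) * + F (suc k)
      ≡⟨ cong (λ z → - Δ (λ k → + F k) k + z * + F (suc k)) (sym (pos-+ 1 (W k))) ⟩
    - Δ (λ k → + F k) k + + (1 ℕ.+ W k) * + F (suc k) ∎
    where
      open ≡-Reasoning
      regroup : ∀ a b w → a + b * w ≡ - (b - a) + (+ 1 + w) * b
      regroup = solve-∀

  private
    variable
      d : ℕ → ℕ

  infix 4 _∣Δ_

  record _∣Δ_ (d : ℕ → ℕ) (f : Seq) : Set where
    constructor ∣Δ-intro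
    field ∣Δ^ : ∀ i k → + d i ∣ℤ Δ^ i f k
  open _∣Δ_ public

  ∣Δ-cong : ∀ {f g} → (∀ k → f k ≡ g k) → d ∣Δ f → d ∣Δ g
  ∣Δ-cong {d} f≡g d∣f = ∣Δ-intro λ i k → subst (+ d i ∣ℤ_) (Δ^-cong i f≡g k) (∣Δ^ d∣f i k)

  ∣Δ-zero : d ∣Δ (λ _ → 0ℤ)
  ∣Δ-zero {d} = ∣Δ-intro λ i k → subst (+ d i ∣ℤ_) (sym (Δ^-zero i (λ _ → refl) k)) (∣ℤ0 (d i))

  1∣Δ : ∀ {f} → (λ _ → 1) ∣Δ f
  1∣Δ = ∣Δ-intro λ i k → 1∣ℤ _

  ∣Δ-weaken : ∀ {d′ f} → (∀ i → d′ i ∣ d i) → d ∣Δ f → d′ ∣Δ f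
  ∣Δ-weaken d′∣d d∣f = ∣Δ-intro λ i k → ∣-trans (∣-+ (d′∣d i)) (∣Δ^ d∣f i k)

  ∣Δ-+ : ∀ {f g} → d ∣Δ f → d ∣Δ g → d ∣Δ (λ k → f k + g k)
  ∣Δ-+ {d} {f} {g} d∣f d∣g = ∣Δ-intro λ i k →
    subst (+ d i ∣ℤ_) (sym (Δ^-+ i f g k)) (∣m∣n⇒∣m+n (∣Δ^ d∣f i k) (∣Δ^ d∣g i k))

  ∣Δ-*ˡ : ∀ c {f} → d ∣Δ f → d ∣Δ (λ k → c * f k)
  ∣Δ-*ˡ {d} c {f} d∣f = ∣Δ-intro λ i k → subst (+ d i ∣ℤ_) (sym (Δ^-*ˡ i c f k)) (∣n⇒∣m*n c (∣Δ^ d∣f i k))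

  ∣Δ-neg : ∀ {f} → d ∣Δ f → d ∣Δ (λ k → - f k)
  ∣Δ-neg d∣f = ∣Δ-cong (λ k → -1*i≡-i _) (∣Δ-*ˡ (- (+ 1)) d∣f)

  ∣Δ-scale : ∀ e {f} → d ∣Δ f → (λ i → e ℕ.* d i) ∣Δ (λ k → + e * f k)
  ∣Δ-scale {d} e {f} d∣f = ∣Δ-intro λ i k →
    subst₂ _∣ℤ_ (sym (pos-* e (d i))) (sym (Δ^-*ˡ i (+ e) f k)) (*-monoʳ-∣ (+ e) (∣Δ^ d∣f i k))

  ∣Δ-sumTo : ∀ {d} n (F : ℕ → ℕ → ℕ) → (∀ l → l ℕ.≤ n → d ∣Δ (λ k → + F l k)) →
             d ∣Δ (λ k → + sumTo n (λ l → F l k))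
  ∣Δ-sumTo zero    F d∣F = d∣F 0 z≤n
  ∣Δ-sumTo (suc n) F d∣F = ∣Δ-cong (λ k → sym (pos-+ (sumTo n (λ l → F l k)) (F (suc n) k)))
    (∣Δ-+ (∣Δ-sumTo n F (λ l l≤n → d∣F l (ℕ.m≤n⇒m≤1+n l≤n))) (d∣F (suc n) ℕ.≤-refl))

  ∣Δ-shift : ∀ {f} → d ∣Δ f → d ∣Δ (f ∘ suc)
  ∣Δ-shift {d} {f} d∣f = ∣Δ-intro λ i k → subst (+ d i ∣ℤ_) (sym (Δ^-shift i f k)) (∣Δ^ d∣f i (suc k))

  ∣Δ-shiftBy : ∀ t {f} → d ∣Δ f → d ∣Δ (λ k → f (k ℕ.+ t))
  ∣Δ-shiftBy zero    {f} d∣f = ∣Δ-cong (λ k → cong f (sym (ℕ.+-identityʳ k))) d∣f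
  ∣Δ-shiftBy (suc t) {f} d∣f = ∣Δ-cong (λ k → cong f (sym (ℕ.+-suc k t))) (∣Δ-shift (∣Δ-shiftBy t d∣f))

  ∣Δ-Δ : ∀ {f} → d ∣Δ f → (d ∘ suc) ∣Δ Δ f
  ∣Δ-Δ d∣f = ∣Δ-intro λ i → ∣Δ^ d∣f (suc i)

  ∣Δ-shift-difference : ∀ t {f} → d ∣Δ f → (d ∘ suc) ∣Δ (λ k → f (k ℕ.+ t) - f k)
  ∣Δ-shift-difference zero    {f} d∣f =
    ∣Δ-cong (λ k → sym (trans (cong (λ j → f j - f k) (ℕ.+-identityʳ k)) (+-inverseʳ (f k)))) ∣Δ-zero
  ∣Δ-shift-difference (suc t) {f} d∣f =
    ∣Δ-cong telescope (∣Δ-+ (∣Δ-shiftBy t (∣Δ-Δ d∣f)) (∣Δ-shift-difference t d∣f))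
    where
      telescope : ∀ k → Δ f (k ℕ.+ t) + (f (k ℕ.+ t) - f k) ≡ f (k ℕ.+ suc t) - f k
      telescope k = trans (cancel (f (suc (k ℕ.+ t))) (f (k ℕ.+ t)) (f k)) (cong (λ j → f j - f k) (sym (ℕ.+-suc k t)))
        where cancel : ∀ a b c → (a - b) + (b - c) ≡ a - c
              cancel = solve-∀

  ∣Δ-degree : ∀ n {f} → (∀ k → Δ^ n f k ≡ 0ℤ) → (∀ i k → i ℕ.< n → + d i ∣ℤ Δ^ i f k) → d ∣Δ f
  ∣Δ-degree {d} n {f} top≡0 low = ∣Δ-intro case
    where
      case : ∀ i → ∀ k → + d i ∣ℤ Δ^ i f k
      case i k with ℕ.<-≤-connex i n
      ... | inj₁ i<n = low i k i<n
      ... | inj₂ n≤i = subst (+ d i ∣ℤ_) (sym high) (∣ℤ0 (d i))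
        where
          high : Δ^ i f k ≡ 0ℤ
          high = begin
            Δ^ i f k                 ≡⟨ cong (λ j → Δ^ j f k) (sym (ℕ.m+[n∸m]≡n n≤i)) ⟩
            Δ^ (n ℕ.+ (i ℕ.∸ n)) f k ≡⟨ Δ^-+-index n (i ℕ.∸ n) f k ⟩
            Δ^ (i ℕ.∸ n) (Δ^ n f) k  ≡⟨ Δ^-zero (i ℕ.∸ n) top≡0 k ⟩
            0ℤ                       ∎
            where open ≡-Reasoning

  ∣Δ-^-⊔ : ∀ (p : ℕ) {ε δ : ℕ → ℕ} {f : Seq} →
           (λ i → p ℕ.^ ε i) ∣Δ f → (λ i → p ℕ.^ δ i) ∣Δ f → (λ i → p ℕ.^ (ε i ℕ.⊔ δ i)) ∣Δ f
  ∣Δ-^-⊔ p {ε} {δ} {f} ε∣f δ∣f = ∣Δ-intro divides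
    where
      divides : ∀ i k → + (p ℕ.^ (ε i ℕ.⊔ δ i)) ∣ℤ Δ^ i f k
      divides i k with ℕ.⊔-sel (ε i) (δ i)
      ... | inj₁ ≡ε = subst (λ x → + (p ℕ.^ x) ∣ℤ Δ^ i f k) (sym ≡ε) (∣Δ^ ε∣f i k)
      ... | inj₂ ≡δ = subst (λ x → + (p ℕ.^ x) ∣ℤ Δ^ i f k) (sym ≡δ) (∣Δ^ δ∣f i k)

  leibniz-∣ : ∀ i {a b : ℕ → ℕ} {f g : Seq} {D} → (∀ j l → j ℕ.+ l ≡ i → D ∣ a j ℕ.* b l) →
              a ∣Δ f → b ∣Δ g → ∀ k → + D ∣ℤ Δ^ i (λ k → f k * g k) k
  leibniz-∣ zero {a} {b} {f} {g} D∣ab a∣f b∣g k =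
    ∣-trans (∣-+ (D∣ab 0 0 refl))
      (subst (_∣ℤ f k * g k) (sym (pos-* (a 0) (b 0))) (*-pres-∣ℤ (∣Δ^ a∣f 0 k) (∣Δ^ b∣g 0 k)))
  leibniz-∣ (suc i) {a} {b} {f} {g} D∣ab a∣f b∣g k =
    subst (_ ∣ℤ_) (sym split) (∣m∣n⇒∣m+n
      (leibniz-∣ i (λ j l j+l≡i → D∣ab (suc j) l (cong suc j+l≡i)) (∣Δ-Δ a∣f) (∣Δ-shift b∣g) k)
      (leibniz-∣ i (λ j l j+l≡i → D∣ab j (suc l) (trans (ℕ.+-suc j l) (cong suc j+l≡i))) a∣f (∣Δ-Δ b∣g) k))
    where
      split : Δ^ (suc i) (λ k → f k * g k) k ≡ Δ^ i (λ k → Δ f k * g (suc k)) k + Δ^ i (λ k → f k * Δ g k) k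
      split = trans (Δ^-cong i (Δ-* f g) k) (Δ^-+ i _ _ k)

  ∣Δ-* : ∀ {a b c : ℕ → ℕ} {f g : Seq} → (∀ j l → c (j ℕ.+ l) ∣ a j ℕ.* b l) →
         a ∣Δ f → b ∣Δ g → c ∣Δ (λ k → f k * g k)
  ∣Δ-* {c = c} c∣ab a∣f b∣g =
    ∣Δ-intro λ i → leibniz-∣ i (λ j l j+l≡i → subst (λ i → c i ∣ _) j+l≡i (c∣ab j l)) a∣f b∣g

module StirlingNumbers where

  open SumTo
  open RisingFactorials
  open import Data.Nat using (ℕ; zero; suc; _+_; _*_; _∸_; _^_; _!; _≤_; _<_; z≤n; s≤s; >-nonZero)
  open import Data.Nat.Properties
  open import Data.Nat.Combinatorics using (_C_; nCk+nC[k+1]≡[n+1]C[k+1]; nC1≡n; nCn≡1; k>n⇒nCk≡0; nCk≡nC[n∸k])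
  open import Data.Nat.Divisibility using (_∣_; divides; ∣⇒≤; ∣m+n∣m⇒∣n; ∣m⇒∣m*n; n∣m*n)
  open import Data.Nat.Primality using (Prime; euclidsLemma; ¬prime[1])
  open import Data.Nat.Tactic.RingSolver using (solve-∀)
  open import Data.Sum using (inj₁; inj₂)
  open import Data.Empty using (⊥-elim)
  open import Relation.Binary.PropositionalEquality

  prime-∣-*-cancel : ∀ {p m n} → Prime p → 0 < m → m < p → p ∣ m * n → p ∣ n
  prime-∣-*-cancel {m = m} {n} p-prime 0<m m<p p∣mn with euclidsLemma m n p-prime p∣mn
  ... | inj₁ p∣m = ⊥-elim (<⇒≱ m<p (∣⇒≤ {{>-nonZero 0<m}} p∣m))
  ... | inj₂ p∣n = p∣n

  C-absorption : ∀ n k → suc k * (suc n C suc k) ≡ suc n * (n C k)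
  C-absorption zero    zero    = refl
  C-absorption zero    (suc k) = *-zeroʳ (suc (suc k))
  C-absorption (suc n) zero    = trans (+-identityʳ _) (trans (nC1≡n (suc (suc n))) (sym (*-identityʳ _)))
  C-absorption (suc n) (suc k) = begin
    suc (suc k) * (suc (suc n) C suc (suc k))
      ≡⟨ cong (suc (suc k) *_) (sym (nCk+nC[k+1]≡[n+1]C[k+1] (suc n) (suc k))) ⟩
    suc (suc k) * (A + B)                       ≡⟨ expand k A B ⟩
    A + suc k * A + suc (suc k) * B             ≡⟨ cong₂ (λ u v → A + u + v) (C-absorption n k) (C-absorption n (suc k)) ⟩
    A + suc n * (n C k) + suc n * (n C suc k)   ≡⟨ +-assoc A _ _ ⟩
    A + (suc n * (n C k) + suc n * (n C suc k)) ≡⟨ cong (A +_) (sym (*-distribˡ-+ (suc n) (n C k) _)) ⟩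
    A + suc n * (n C k + n C suc k)             ≡⟨ cong (λ z → A + suc n * z) (nCk+nC[k+1]≡[n+1]C[k+1] n k) ⟩
    suc (suc n) * A                             ∎
    where
      open ≡-Reasoning
      A = suc n C suc k
      B = suc n C suc (suc k)
      expand : ∀ k a b → suc (suc k) * (a + b) ≡ a + suc k * a + suc (suc k) * b
      expand = solve-∀

  prime-∣-C : ∀ {p} → Prime p → ∀ l → 0 < l → l < p → p ∣ p C l
  prime-∣-C {suc n} p-prime (suc k) 0<l l<p =
    prime-∣-*-cancel p-prime 0<l l<p (divides (n C k) (trans (C-absorption n k) (*-comm (suc n) _)))

  -- s(n, l) = stirling n l is the coefficient of x^l in (x+1)⋯(x+n), the unsigned Stirling number [n+1, l+1].
  stirling : ℕ → ℕ → ℕ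
  stirling zero    zero    = 1
  stirling zero    (suc l) = 0
  stirling (suc n) zero    = stirling n 0 * suc n
  stirling (suc n) (suc l) = stirling n l + stirling n (suc l) * suc n

  stirling-> : ∀ {n l} → n < l → stirling n l ≡ 0
  stirling-> {zero}  {suc l} _           = refl
  stirling-> {suc n} {suc l} (s≤s n<l) =
    cong₂ _+_ (stirling-> n<l) (cong (_* suc n) (stirling-> (m<n⇒m<1+n n<l)))

  stirling-diagonal : ∀ n → stirling n n ≡ 1
  stirling-diagonal zero    = refl
  stirling-diagonal (suc n) = cong₂ _+_ (stirling-diagonal n) (cong (_* suc n) (stirling-> (n<1+n n)))

  rising-expansion : ∀ x n → rising x n ≡ sumTo n (λ l → stirling n l * x ^ l)
  rising-expansion x zero    = refl
  rising-expansion x (suc n) = begin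
    rising x n * (x + suc n)
      ≡⟨ *-distribˡ-+ (rising x n) x (suc n) ⟩
    rising x n * x + rising x n * suc n
      ≡⟨ cong₂ _+_ (byX n) (byIndex n) ⟩
    sumTo n (λ l → c l * x ^ suc l) + (c 0 * suc n + sumTo n (λ l → c (suc l) * suc n * x ^ suc l))
      ≡⟨ x+[y+z]≡y+[x+z] (sumTo n (λ l → c l * x ^ suc l)) (c 0 * suc n) _ ⟩
    c 0 * suc n + (sumTo n (λ l → c l * x ^ suc l) + sumTo n (λ l → c (suc l) * suc n * x ^ suc l))
      ≡⟨ cong₂ _+_ (sym (*-identityʳ (c 0 * suc n))) (sym (sumTo-+ n _ _)) ⟩
    c 0 * suc n * 1 + sumTo n (λ l → c l * x ^ suc l + c (suc l) * suc n * x ^ suc l)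
      ≡⟨ cong (c 0 * suc n * 1 +_) (sumTo-cong n (λ l _ → sym (*-distribʳ-+ (x ^ suc l) (c l) _))) ⟩
    c 0 * suc n * 1 + sumTo n (λ l → stirling (suc n) (suc l) * x ^ suc l)
      ≡⟨ sym (sumTo-suc n (λ l → stirling (suc n) l * x ^ l)) ⟩
    sumTo (suc n) (λ l → stirling (suc n) l * x ^ l) ∎
    where
      open ≡-Reasoning
      c = stirling n
      x+[y+z]≡y+[x+z] : ∀ a b c → a + (b + c) ≡ b + (a + c)
      x+[y+z]≡y+[x+z] = solve-∀
      byX : ∀ n → rising x n * x ≡ sumTo n (λ l → stirling n l * x ^ suc l)
      byX n = begin
        rising x n * x                            ≡⟨ cong (_* x) (rising-expansion x n) ⟩
        sumTo n (λ l → stirling n l * x ^ l) * x  ≡⟨ sym (sumTo-*ʳ n _ x) ⟩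
        sumTo n (λ l → stirling n l * x ^ l * x)  ≡⟨ sumTo-cong n (λ l _ → regroup (stirling n l) (x ^ l) x) ⟩
        sumTo n (λ l → stirling n l * x ^ suc l)  ∎
        where regroup : ∀ a b x → a * b * x ≡ a * (x * b)
              regroup = solve-∀
      byIndex : ∀ n → rising x n * suc n ≡ stirling n 0 * suc n + sumTo n (λ l → stirling n (suc l) * suc n * x ^ suc l)
      byIndex n = begin
        rising x n * suc n                                   ≡⟨ cong (_* suc n) (rising-expansion x n) ⟩
        sumTo n (λ l → stirling n l * x ^ l) * suc n         ≡⟨ sym (sumTo-*ʳ n _ (suc n)) ⟩
        sumTo n (λ l → stirling n l * x ^ l * suc n)
          ≡⟨ sumTo-peel n _ (cong (λ z → z * x ^ suc n * suc n) (stirling-> (n<1+n n))) ⟩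
        stirling n 0 * 1 * suc n + sumTo n (λ l → stirling n (suc l) * x ^ suc l * suc n)
          ≡⟨ cong₂ _+_ (cong (_* suc n) (*-identityʳ (stirling n 0)))
                       (sumTo-cong n (λ l _ → swap (stirling n (suc l)) (x ^ suc l) (suc n))) ⟩
        stirling n 0 * suc n + sumTo n (λ l → stirling n (suc l) * suc n * x ^ suc l) ∎
        where swap : ∀ a b d → a * b * d ≡ a * d * b
              swap = solve-∀

  binomialRow : ℕ → ℕ → ℕ → ℕ
  binomialRow n t l = sumTo n (λ j → stirling n j * ((t + j) C l))

  binomialRow-suc : ∀ n l → binomialRow (suc n) 1 l ≡ binomialRow n 2 l + binomialRow n 1 l * suc n
  binomialRow-suc n l = begin
    binomialRow (suc n) 1 l
      ≡⟨ sumTo-suc n _ ⟩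
    c 0 * suc n * (1 C l) + sumTo n (λ j → (c j + c (suc j) * suc n) * ((2 + j) C l))
      ≡⟨ cong (c 0 * suc n * (1 C l) +_) (trans (sumTo-cong n (λ j _ → *-distribʳ-+ ((2 + j) C l) (c j) _)) (sumTo-+ n _ _)) ⟩
    c 0 * suc n * (1 C l) + (binomialRow n 2 l + sumTo n (λ j → c (suc j) * suc n * ((2 + j) C l)))
      ≡⟨ x+[y+z]≡y+[x+z] (c 0 * suc n * (1 C l)) (binomialRow n 2 l) _ ⟩
    binomialRow n 2 l + (c 0 * suc n * (1 C l) + sumTo n (λ j → c (suc j) * suc n * ((2 + j) C l)))
      ≡⟨ cong (binomialRow n 2 l +_) (sym scaled) ⟩
    binomialRow n 2 l + binomialRow n 1 l * suc n ∎
    where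
      open ≡-Reasoning
      c = stirling n
      x+[y+z]≡y+[x+z] : ∀ a b c → a + (b + c) ≡ b + (a + c)
      x+[y+z]≡y+[x+z] = solve-∀
      swap : ∀ a b d → a * b * d ≡ a * d * b
      swap = solve-∀
      scaled : binomialRow n 1 l * suc n ≡ c 0 * suc n * (1 C l) + sumTo n (λ j → c (suc j) * suc n * ((2 + j) C l))
      scaled = begin
        binomialRow n 1 l * suc n
          ≡⟨ sym (sumTo-*ʳ n _ (suc n)) ⟩
        sumTo n (λ j → c j * ((1 + j) C l) * suc n)
          ≡⟨ sumTo-peel n _ (cong (λ z → z * ((2 + n) C l) * suc n) (stirling-> (n<1+n n))) ⟩
        c 0 * (1 C l) * suc n + sumTo n (λ j → c (suc j) * ((2 + j) C l) * suc n)
          ≡⟨ cong₂ _+_ (swap (c 0) (1 C l) (suc n)) (sumTo-cong n (λ j _ → swap (c (suc j)) _ (suc n))) ⟩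
        c 0 * suc n * (1 C l) + sumTo n (λ j → c (suc j) * suc n * ((2 + j) C l)) ∎

  binomialRow-pascal : ∀ n l → binomialRow n 2 (suc l) ≡ binomialRow n 1 l + binomialRow n 1 (suc l)
  binomialRow-pascal n l = trans
    (sumTo-cong n (λ j _ → trans (cong (stirling n j *_) (sym (nCk+nC[k+1]≡[n+1]C[k+1] (suc j) l)))
                                (*-distribˡ-+ (stirling n j) _ _)))
    (sumTo-+ n _ _)

  -- Coefficients of x^l in (x+1) · rising (x+1) n = rising x (n+1).
  stirling-binomial : ∀ n l → binomialRow n 1 l ≡ stirling (suc n) l
  stirling-binomial zero    zero          = refl
  stirling-binomial zero    (suc zero)    = refl
  stirling-binomial zero    (suc (suc l)) = refl
  stirling-binomial (suc n) zero = begin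
    binomialRow (suc n) 1 0                        ≡⟨ binomialRow-suc n 0 ⟩
    binomialRow n 2 0 + binomialRow n 1 0 * suc n  ≡⟨⟩
    binomialRow n 1 0 + binomialRow n 1 0 * suc n  ≡⟨ cong (λ z → z + z * suc n) (stirling-binomial n 0) ⟩
    c₀ + c₀ * suc n                                ≡⟨ factor c₀ n ⟩
    c₀ * suc (suc n)                               ∎
    where
      open ≡-Reasoning
      c₀ = stirling (suc n) 0
      factor : ∀ a n → a + a * suc n ≡ a * suc (suc n)
      factor = solve-∀
  stirling-binomial (suc n) (suc l) = begin
    binomialRow (suc n) 1 (suc l)
      ≡⟨ binomialRow-suc n (suc l) ⟩
    binomialRow n 2 (suc l) + binomialRow n 1 (suc l) * suc n
      ≡⟨ cong (_+ binomialRow n 1 (suc l) * suc n) (binomialRow-pascal n l) ⟩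
    binomialRow n 1 l + binomialRow n 1 (suc l) + binomialRow n 1 (suc l) * suc n
      ≡⟨ cong₂ (λ u v → u + v + v * suc n) (stirling-binomial n l) (stirling-binomial n (suc l)) ⟩
    stirling (suc n) l + stirling (suc n) (suc l) + stirling (suc n) (suc l) * suc n
      ≡⟨ factor (stirling (suc n) l) (stirling (suc n) (suc l)) n ⟩
    stirling (suc n) l + stirling (suc n) (suc l) * suc (suc n) ∎
    where
      open ≡-Reasoning
      factor : ∀ a b n → a + b + b * suc n ≡ a + b * suc (suc n)
      factor = solve-∀

  stirling-zero : ∀ n → stirling n 0 ≡ n !
  stirling-zero zero    = refl
  stirling-zero (suc n) = trans (cong (_* suc n) (stirling-zero n)) (*-comm (n !) (suc n))

  module _ {N : ℕ} (p-prime : Prime (suc N)) where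

    private
      p = suc N

    -- In stirling-binomial N l the term j = l − 1 cancels s(N, l−1) on the right and the terms
    -- j > l are multiples of p (the last one by p ∣ C(p, l)); what remains is (l+1) s(N,l) ≡ 0.
    stirling-∣-step : ∀ l → 0 < l → l < N → (∀ j → l < j → j < N → p ∣ stirling N j) → p ∣ stirling N l
    stirling-∣-step l@(suc l′) 0<l l<N higher = prime-∣-*-cancel p-prime (s≤s z≤n) (s≤s l<N) p∣[1+l]c
      where
        c = stirling N
        f : ℕ → ℕ
        f j = c j * ((1 + j) C l)
        d = N ∸ suc l
        l+1+d≡N : l + suc d ≡ N
        l+1+d≡N = trans (+-suc l d) (m+[n∸m]≡n l<N)
        l+1+d≤N : suc l + d ≤ N
        l+1+d≤N = ≤-reflexive (trans (sym (+-suc l d)) l+1+d≡N)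
        rest = sumTo d (λ j → f (suc l + j))
        p∣rest : p ∣ rest
        p∣rest = ∣-sumTo d _ term
          where
            term : ∀ j → j ≤ d → p ∣ f (suc l + j)
            term j j≤d with m≤n⇒m<n∨m≡n (≤-trans (+-monoʳ-≤ (suc l) j≤d) l+1+d≤N)
            ... | inj₁ l+1+j<N = ∣m⇒∣m*n _ (higher (suc l + j) (s≤s (m≤m+n l j)) l+1+j<N)
            ... | inj₂ refl    = subst (p ∣_) (sym (trans (cong (_* (p C l)) (stirling-diagonal N)) (*-identityˡ _)))
                                   (prime-∣-C p-prime l 0<l (≤-trans (s≤s (m≤m+n l j)) (n≤1+n _)))
        lowTerms : sumTo l f ≡ c l′ + c l * suc l
        lowTerms = cong₂ _+_
          (trans (sumTo-last l′ f (λ j j<l′ → trans (cong (c j *_) (k>n⇒nCk≡0 (s≤s j<l′))) (*-zeroʳ (c j))))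
                 (trans (cong (c l′ *_) (nCn≡1 l)) (*-identityʳ _)))
          (cong (c l *_) (trans (nCk≡nC[n∸k] (n≤1+n l)) (trans (cong (suc l C_) (m+n∸n≡m 1 l)) (nC1≡n (suc l)))))
        total : c l′ + (c l * suc l + rest) ≡ c l′ + c l * p
        total = begin
          c l′ + (c l * suc l + rest) ≡⟨ sym (+-assoc (c l′) _ rest) ⟩
          c l′ + c l * suc l + rest   ≡⟨ cong (_+ rest) (sym lowTerms) ⟩
          sumTo l f + rest            ≡⟨ sym (sumTo-split l d f) ⟩
          sumTo (l + suc d) f         ≡⟨ cong (λ z → sumTo z f) l+1+d≡N ⟩
          binomialRow N 1 l           ≡⟨ stirling-binomial N l ⟩
          c l′ + c l * p              ∎
          where open ≡-Reasoning
        p∣[1+l]c : p ∣ suc l * c l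
        p∣[1+l]c = subst (p ∣_) (*-comm (c l) (suc l))
          (∣m+n∣m⇒∣n (subst (p ∣_) (trans (+-cancelˡ-≡ (c l′) _ _ (sym total)) (+-comm _ rest)) (n∣m*n (c l))) p∣rest)

    stirling-∣-above : ∀ t l → 0 < l → l < N → N ≤ l + t → p ∣ stirling N l
    stirling-∣-above zero    l _   l<N N≤l+0 = ⊥-elim (<⇒≱ l<N (subst (N ≤_) (+-identityʳ l) N≤l+0))
    stirling-∣-above (suc t) l 0<l l<N N≤l+1+t = stirling-∣-step l 0<l l<N (λ j l<j j<N →
      stirling-∣-above t j (<-trans 0<l l<j) j<N (≤-trans N≤l+1+t (≤-trans (≤-reflexive (+-suc l t)) (+-monoˡ-≤ t l<j))))

    stirling-∣ : ∀ l → 0 < l → l < N → p ∣ stirling N l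
    stirling-∣ l 0<l l<N = stirling-∣-above N l 0<l l<N (m≤n+m N l)

  -- The s(N, j) sum to p! by stirling-binomial N 0, and all of them except s(N, 0) = N! and
  -- s(N, N) = 1 are multiples of p.
  wilson : ∀ {N} → Prime (suc N) → suc N ∣ N ! + 1
  wilson {zero}          p-prime = ⊥-elim (¬prime[1] p-prime)
  wilson {suc zero}      p-prime = divides 1 refl
  wilson {N@(suc (suc M))} p-prime = ∣m+n∣m⇒∣n (subst (suc N ∣_) regroup p∣∑c) p∣middle
    where
      c = stirling N
      middle = sumTo M (λ j → c (suc j) * 1)
      p∣∑c : suc N ∣ sumTo N (λ j → c j * 1)
      p∣∑c = subst (suc N ∣_) (sym (stirling-binomial N 0)) (n∣m*n (c 0))
      p∣middle : suc N ∣ middle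
      p∣middle = ∣-sumTo M _ (λ j j≤M → ∣m⇒∣m*n 1 (stirling-∣ p-prime (suc j) (s≤s z≤n) (s≤s (s≤s j≤M))))
      regroup : sumTo N (λ j → c j * 1) ≡ middle + (N ! + 1)
      regroup = begin
        sumTo N (λ j → c j * 1)      ≡⟨ sumTo-suc (suc M) _ ⟩
        c 0 * 1 + (middle + c N * 1) ≡⟨ cong₂ (λ u v → u + (middle + v)) (trans (*-identityʳ _) (stirling-zero N))
                                                                       (trans (*-identityʳ _) (stirling-diagonal N)) ⟩
        N ! + (middle + 1)           ≡⟨ x+[y+1]≡y+[x+1] (N !) middle ⟩
        middle + (N ! + 1)           ∎
        where
          open ≡-Reasoning
          x+[y+1]≡y+[x+1] : ∀ a b → a + (b + 1) ≡ b + (a + 1)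
          x+[y+1]≡y+[x+1] = solve-∀

module WeightedShifts where

  open SumTo
  open FiniteDifferences
  open NonMultiples
  open Arithmetic
  open import Data.Nat using (ℕ; zero; suc; _+_; _*_; _∸_; _^_; _≤_; NonZero)
  open import Data.Nat.Properties
  open import Data.Nat.Combinatorics using (_C_; nCk+nC[k+1]≡[n+1]C[k+1]; k>n⇒nCk≡0)
  open import Data.Nat.Divisibility using (_∣_)
  import Data.Integer as ℤ
  open import Data.Integer.Divisibility.Signed using (∣⇒∣ᵤ) renaming (_∣_ to _∣ℤ_)

  open import Data.Nat.Tactic.RingSolver using (solve-∀)
  open import Relation.Binary.PropositionalEquality

  module _ (W : ℕ → ℕ) where

    weightedStep : (ℕ → ℕ) → ℕ → ℕ
    weightedStep F k = F k + F (suc k) * W k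

    weightedStep^ : ℕ → (ℕ → ℕ) → ℕ → ℕ
    weightedStep^ zero    F = F
    weightedStep^ (suc a) F = weightedStep^ a (weightedStep F)

    partialProduct : ℕ → ℕ
    partialProduct zero    = 1
    partialProduct (suc k) = partialProduct k * W k

  binomialShift : ℕ → (ℕ → ℕ) → ℕ → ℕ
  binomialShift a G k = sumTo a (λ r → G (k + r) * (a C r))

  binomialShift-cong : ∀ a {G H : ℕ → ℕ} → (∀ k → G k ≡ H k) → ∀ k → binomialShift a G k ≡ binomialShift a H k
  binomialShift-cong a G≡H k = sumTo-cong a (λ r _ → cong (_* (a C r)) (G≡H (k + r)))

  pascal-sumTo : ∀ a (h : ℕ → ℕ) →
                 sumTo (suc a) (λ r → h r * (suc a C r)) ≡ sumTo a (λ r → (h r + h (suc r)) * (a C r))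
  pascal-sumTo a h = begin
    sumTo (suc a) (λ r → h r * (suc a C r))
      ≡⟨ sumTo-suc a _ ⟩
    h 0 * 1 + sumTo a (λ r → h (suc r) * (suc a C suc r))
      ≡⟨ cong ((h 0 * 1) +_) (trans (sumTo-cong a (λ r _ → pascal r)) (sumTo-+ a _ _)) ⟩
    h 0 * 1 + (shifted + sumTo a (λ r → h (suc r) * (a C suc r)))
      ≡⟨ rearrange (h 0 * 1) shifted _ ⟩
    (h 0 * 1 + sumTo a (λ r → h (suc r) * (a C suc r))) + shifted
      ≡⟨ cong (_+ shifted) (sym (sumTo-suc a unshifted)) ⟩
    sumTo (suc a) unshifted + shifted
      ≡⟨ cong (λ z → sumTo a unshifted + z + shifted) lastTerm ⟩
    sumTo a unshifted + 0 + shifted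
      ≡⟨ cong (_+ shifted) (+-identityʳ _) ⟩
    sumTo a unshifted + shifted
      ≡⟨ sym (sumTo-+ a _ _) ⟩
    sumTo a (λ r → h r * (a C r) + h (suc r) * (a C r))
      ≡⟨ sumTo-cong a (λ r _ → sym (*-distribʳ-+ (a C r) (h r) (h (suc r)))) ⟩
    sumTo a (λ r → (h r + h (suc r)) * (a C r)) ∎
    where
      open ≡-Reasoning
      unshifted = λ r → h r * (a C r)
      shifted = sumTo a (λ r → h (suc r) * (a C r))
      pascal : ∀ r → h (suc r) * (suc a C suc r) ≡ h (suc r) * (a C r) + h (suc r) * (a C suc r)
      pascal r = trans (cong (h (suc r) *_) (sym (nCk+nC[k+1]≡[n+1]C[k+1] a r))) (*-distribˡ-+ (h (suc r)) _ _)
      rearrange : ∀ x y z → x + (y + z) ≡ (x + z) + y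
      rearrange = solve-∀
      lastTerm : h (suc a) * (a C suc a) ≡ 0
      lastTerm = trans (cong (h (suc a) *_) (k>n⇒nCk≡0 (n<1+n a))) (*-zeroʳ (h (suc a)))

  binomialShift-suc : ∀ a G k → binomialShift (suc a) G k ≡ binomialShift a (λ k → G k + G (suc k)) k
  binomialShift-suc a G k = trans (pascal-sumTo a (λ r → G (k + r)))
    (sumTo-cong a (λ r _ → cong (λ z → (G (k + r) + G z) * (a C r)) (+-suc k r)))

  binomialShift-partialProduct : ∀ W a F k →
    binomialShift a (λ k → F k * partialProduct W k) k ≡ weightedStep^ W a F k * partialProduct W k
  binomialShift-partialProduct W zero    F k = trans (*-identityʳ _) (cong (λ z → F z * partialProduct W z) (+-identityʳ k))
  binomialShift-partialProduct W (suc a) F k = begin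
    binomialShift (suc a) (λ k → F k * V k) k
      ≡⟨ binomialShift-suc a (λ k → F k * V k) k ⟩
    binomialShift a (λ k → F k * V k + F (suc k) * (V k * W k)) k
      ≡⟨ binomialShift-cong a (λ k → factor (F k) (F (suc k)) (V k) (W k)) k ⟩
    binomialShift a (λ k → weightedStep W F k * V k) k
      ≡⟨ binomialShift-partialProduct W a (weightedStep W F) k ⟩
    weightedStep^ W (suc a) F k * V k ∎
    where
      open ≡-Reasoning
      V = partialProduct W
      factor : ∀ a b v w → a * v + b * (v * w) ≡ (a + b * w) * v
      factor = solve-∀

  module _ (p : ℕ) .{{_ : NonZero p}} {W : ℕ → ℕ}
           (1+W∣Δ : (λ i → p ^ nonMultiples p (suc i)) ∣Δ (λ k → ℤ.+ (1 + W k))) where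

    weightedStep-∣Δ : ∀ {ε ε′ : ℕ → ℕ} {F : ℕ → ℕ} →
      (∀ i → ε′ i ≤ ε (suc i)) → (∀ j l → ε′ (j + l) ≤ nonMultiples p (suc j) + ε l) →
      (λ i → p ^ ε i) ∣Δ (λ k → ℤ.+ F k) → (λ i → p ^ ε′ i) ∣Δ (λ k → ℤ.+ weightedStep W F k)
    weightedStep-∣Δ {ε} {F = F} ε′≤ε ε′≤ F∣Δ =
      ∣Δ-cong (λ k → sym (shiftedProduct-as-difference F W k))
        (∣Δ-+ (∣Δ-neg (∣Δ-weaken (λ i → ^-monoʳ-∣ p (ε′≤ε i)) (∣Δ-Δ F∣Δ)))
              (∣Δ-* (λ j l → ^-∣-* p _ (ε l) (ε′≤ j l)) 1+W∣Δ (∣Δ-shift F∣Δ)))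

    weightedStep^-∣Δ : ∀ m a e {F} →
      (λ i → p ^ nonMultiples p (e + i ∸ m)) ∣Δ (λ k → ℤ.+ F k) →
      (λ i → p ^ nonMultiples p (a + e + i ∸ m)) ∣Δ (λ k → ℤ.+ weightedStep^ W a F k)
    weightedStep^-∣Δ m zero    e F∣Δ = F∣Δ
    weightedStep^-∣Δ m (suc a) e {F} F∣Δ =
      subst (λ x → (λ i → p ^ nonMultiples p (x + i ∸ m)) ∣Δ (λ k → ℤ.+ weightedStep^ W (suc a) F k)) (+-suc a e)
        (weightedStep^-∣Δ m a (suc e) (weightedStep-∣Δ shift leibniz F∣Δ))
      where
        shift : ∀ i → nonMultiples p (suc e + i ∸ m) ≤ nonMultiples p (e + suc i ∸ m)
        shift i = ≤-reflexive (cong (λ x → nonMultiples p (x ∸ m)) (sym (+-suc e i)))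
        leibniz : ∀ j l → nonMultiples p (suc e + (j + l) ∸ m) ≤ nonMultiples p (suc j) + nonMultiples p (e + l ∸ m)
        leibniz j l = begin
          nonMultiples p (suc e + (j + l) ∸ m)       ≡⟨ cong (λ x → nonMultiples p (x ∸ m)) (swap e j l) ⟩
          nonMultiples p (suc j + (e + l) ∸ m)       ≤⟨ nonMultiples-mono p (+-∸-≤ (suc j) (e + l) m) ⟩
          nonMultiples p (suc j + (e + l ∸ m))       ≤⟨ nonMultiples-subadditive p (suc j) (e + l ∸ m) ⟩
          nonMultiples p (suc j) + nonMultiples p (e + l ∸ m) ∎
          where
            open ≤-Reasoning
            swap : ∀ e j l → suc e + (j + l) ≡ suc j + (e + l)
            swap = solve-∀

    weightedStep^-∣ : ∀ m a {F} → (λ i → p ^ nonMultiples p (i ∸ m)) ∣Δ (λ k → ℤ.+ F k) →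
                      ∀ k → p ^ nonMultiples p (a ∸ m) ∣ weightedStep^ W a F k
    weightedStep^-∣ m a {F} F∣Δ k =
      subst (λ x → p ^ nonMultiples p (x ∸ m) ∣ weightedStep^ W a F k) (trans (+-identityʳ _) (+-identityʳ a))
        (∣⇒∣ᵤ (∣Δ^ (weightedStep^-∣Δ m a 0 F∣Δ) 0 k))

  module _ (p : ℕ) .{{_ : NonZero p}} where

    binomial-∣Δ : ∀ m → (λ i → p ^ nonMultiples p (i ∸ m)) ∣Δ (λ k → ℤ.+ ((k + m) C m))
    binomial-∣Δ m = ∣Δ-degree (suc m) (Δ^-binomial m m) (λ i k i≤m →
      subst (λ e → ℤ.+ (p ^ e) ∣ℤ Δ^ i (λ k → ℤ.+ ((k + m) C m)) k)
            (sym (trans (cong (nonMultiples p) (m≤n⇒m∸n≡0 (≤-pred i≤m))) (nonMultiples-zero p))) (1∣ℤ _))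

module FactorialBlocks where

  open SumTo
  open RisingFactorials
  open WeightedShifts using (partialProduct; weightedStep^; binomialShift; binomialShift-partialProduct)
  open import Data.Nat using (ℕ; zero; suc; _+_; _*_; _∸_; _^_; _!; _/_; _%_; _≤_)
  open import Data.Nat.Properties
  open import Data.Nat.DivMod using (m≡m%n+[m/n]*n; m%n<n; m*[n/m]≡n; /-congˡ; m*n/n≡m)
  open import Data.Nat.Combinatorics using (_C_; nCk≡n!/k![n-k]!; k![n∸k]!∣n!)
  open import Data.Nat.Tactic.RingSolver using (solve-∀)
  open import Relation.Binary.PropositionalEquality

  !-C : ∀ k m → (k + m) ! ≡ m ! * k ! * ((k + m) C m)
  !-C k m = begin
    (k + m) !                                           ≡⟨ sym (m*[n/m]≡n (k![n∸k]!∣n! (m≤n+m m k))) ⟩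
    m ! * (k + m ∸ m) ! * ((k + m) ! / (m ! * (k + m ∸ m) !))
      ≡⟨ cong (m ! * (k + m ∸ m) ! *_) (sym (nCk≡n!/k![n-k]! (m≤n+m m k))) ⟩
    m ! * (k + m ∸ m) ! * ((k + m) C m)                 ≡⟨ cong (λ z → m ! * z ! * ((k + m) C m)) (m+n∸n≡m k m) ⟩
    m ! * k ! * ((k + m) C m)                           ∎
    where
      open ≡-Reasoning
      instance _ = m*n≢0 (m !) ((k + m ∸ m) !) {{m !≢0}} {{(k + m ∸ m) !≢0}}

  module Blocks (N n : ℕ) where

    p = suc N
    m = n / p
    s = n % p

    s≤N : s ≤ N
    s≤N = ≤-pred (m%n<n n p)

    n≡m*p+s : n ≡ m * p + s
    n≡m*p+s = trans (m≡m%n+[m/n]*n n p) (+-comm s (m * p))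

    -- The product of the integers in (kp + n, (k+1)p + n] other than (k + m + 1)p, the only
    -- multiple of p among them.
    blockUnits : ℕ → ℕ
    blockUnits k = rising (k * p + n) (N ∸ s) * rising (k * p + suc m * p) s

    V : ℕ → ℕ
    V = partialProduct blockUnits

    block-! : ∀ k → (suc k * p + n) ! ≡ (k * p + n) ! * (suc (k + m) * p) * blockUnits k
    block-! k = begin
      (suc k * p + n) !                               ≡⟨ cong _! length ⟩
      (x + (suc a + s)) !                             ≡⟨ rising-! x (suc a + s) ⟩
      x ! * rising x (suc a + s)                      ≡⟨ cong (x ! *_) (rising-+ x (suc a) s) ⟩
      x ! * (rising x a * (x + suc a) * rising (x + suc a) s)
        ≡⟨ cong (λ y → x ! * (rising x a * y * rising y s)) nextMultiple ⟩
      x ! * (rising x a * (k * p + suc m * p) * rising (k * p + suc m * p) s)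
        ≡⟨ cong (λ y → x ! * (rising x a * y * rising (k * p + suc m * p) s)) (multiple k m) ⟩
      x ! * (rising x a * (suc (k + m) * p) * rising (k * p + suc m * p) s)
        ≡⟨ rearrange (x !) (rising x a) (suc (k + m) * p) _ ⟩
      x ! * (suc (k + m) * p) * blockUnits k          ∎
      where
        open ≡-Reasoning
        x = k * p + n
        a = N ∸ s
        a+s≡N : a + s ≡ N
        a+s≡N = m∸n+n≡m s≤N
        n+1+a≡[1+m]p : n + suc a ≡ suc m * p
        n+1+a≡[1+m]p = begin
          n + suc a           ≡⟨ cong (_+ suc a) n≡m*p+s ⟩
          m * p + s + suc a   ≡⟨ shuffle (m * p) s a ⟩
          m * p + suc (a + s) ≡⟨ cong (λ z → m * p + suc z) a+s≡N ⟩
          m * p + p           ≡⟨ +-comm (m * p) p ⟩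
          suc m * p           ∎
          where shuffle : ∀ x s a → x + s + suc a ≡ x + suc (a + s)
                shuffle = solve-∀
        length : suc k * p + n ≡ x + (suc a + s)
        length = trans (shift k n N) (cong (λ z → k * p + n + suc z) (sym a+s≡N))
          where shift : ∀ k n N → suc k * suc N + n ≡ k * suc N + n + suc N
                shift = solve-∀
        nextMultiple : x + suc a ≡ k * p + suc m * p
        nextMultiple = trans (+-assoc (k * p) n (suc a)) (cong (k * p +_) n+1+a≡[1+m]p)
        multiple : ∀ k m → k * p + suc m * p ≡ suc (k + m) * p
        multiple k m = sym (trans (cong (p +_) (*-distribʳ-+ p k m)) (x+[y+z]≡y+[x+z] p (k * p) (m * p)))
          where x+[y+z]≡y+[x+z] : ∀ x y z → x + (y + z) ≡ y + (x + z)
                x+[y+z]≡y+[x+z] = solve-∀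
        rearrange : ∀ f r c t → f * (r * c * t) ≡ f * c * (r * t)
        rearrange = solve-∀

    !-decomposition′ : ∀ k → (k * p + n) ! * m ! ≡ n ! * V k * p ^ k * (k + m) !
    !-decomposition′ zero    = solveBase (n !) (m !)
      where solveBase : ∀ a b → a * b ≡ a * 1 * 1 * b
            solveBase = solve-∀
    !-decomposition′ (suc k) = begin
      (suc k * p + n) ! * m !                                   ≡⟨ cong (_* m !) (block-! k) ⟩
      (k * p + n) ! * (suc (k + m) * p) * blockUnits k * m !    ≡⟨ rearrange₁ ((k * p + n) !) _ (blockUnits k) (m !) ⟩
      (k * p + n) ! * m ! * (suc (k + m) * p * blockUnits k)
        ≡⟨ cong (_* (suc (k + m) * p * blockUnits k)) (!-decomposition′ k) ⟩
      n ! * V k * p ^ k * (k + m) ! * (suc (k + m) * p * blockUnits k)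
        ≡⟨ rearrange₂ (n !) (V k) (p ^ k) ((k + m) !) (k + m) p (blockUnits k) ⟩
      n ! * (V k * blockUnits k) * (p * p ^ k) * (suc (k + m) * (k + m) !) ∎
      where
        open ≡-Reasoning
        rearrange₁ : ∀ a b c d → a * b * c * d ≡ a * d * (b * c)
        rearrange₁ = solve-∀
        rearrange₂ : ∀ f v q g j p w → f * v * q * g * (suc j * p * w) ≡ f * (v * w) * (p * q) * (suc j * g)
        rearrange₂ = solve-∀

    !-decomposition : ∀ k → (k * p + n) ! ≡ n ! * (((k + m) C m) * V k) * (k ! * p ^ k)
    !-decomposition k = *-cancelʳ-≡ _ _ (m !) {{m !≢0}} (begin
      (k * p + n) ! * m !                         ≡⟨ !-decomposition′ k ⟩
      n ! * V k * p ^ k * (k + m) !               ≡⟨ cong (n ! * V k * p ^ k *_) (!-C k m) ⟩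
      n ! * V k * p ^ k * (m ! * k ! * ((k + m) C m)) ≡⟨ rearrange (n !) (V k) (p ^ k) (m !) (k !) ((k + m) C m) ⟩
      n ! * (((k + m) C m) * V k) * (k ! * p ^ k) * m ! ∎)
      where
        open ≡-Reasoning
        rearrange : ∀ f v q a b c → f * v * q * (a * b * c) ≡ f * (c * v) * (b * q) * a
        rearrange = solve-∀

    summand-decomposition : ∀ q r → summand p q n r ≡ n ! * (((r + q + m) C m) * V (r + q))
    summand-decomposition q r = trans (/-congˡ (!-decomposition (r + q))) (m*n/n≡m _ _)
      where instance _ = m*n≢0 ((r + q) !) (p ^ (r + q)) {{(r + q) !≢0}} {{m^n≢0 p (r + q)}}

    S-decomposition : ∀ a q → S p a q n ≡ n ! * (weightedStep^ blockUnits a (λ k → (k + m) C m) q * V q)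
    S-decomposition a q = begin
      S p a q n
        ≡⟨ sumTo-cong a (λ r _ → trans (cong (_* (a C r)) (summand-decomposition q r)) (rearrange r)) ⟩
      sumTo a (λ r → n ! * (((q + r + m) C m) * V (q + r) * (a C r)))
        ≡⟨ sumTo-*ˡ a _ (n !) ⟩
      n ! * binomialShift a (λ k → ((k + m) C m) * V k) q
        ≡⟨ cong (n ! *_) (binomialShift-partialProduct blockUnits a (λ k → (k + m) C m) q) ⟩
      n ! * (weightedStep^ blockUnits a (λ k → (k + m) C m) q * V q) ∎
      where
        open ≡-Reasoning
        rearrange : ∀ r → n ! * (((r + q + m) C m) * V (r + q)) * (a C r) ≡ n ! * (((q + r + m) C m) * V (q + r) * (a C r))
        rearrange r = trans (*-assoc (n !) _ _) (cong (λ z → n ! * (((z + m) C m) * V z * (a C r))) (+-comm r q))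

module BlockUnits where

  open SumTo
  open FiniteDifferences
  open NonMultiples
  open RisingFactorials
  open StirlingNumbers
  open FactorialBlocks
  open Arithmetic using (^-monoʳ-∣; *-^)
  open import Data.Nat as ℕ using (ℕ; zero; suc; z≤n; s≤s; _≤_; _<_)
  import Data.Nat.Properties as ℕ
  open import Data.Nat.Divisibility using (_∣_; divides; ∣-reflexive; ∣-trans)
  open import Data.Nat.Primality using (Prime; prime⇒nonTrivial)
  open import Data.Integer using (ℤ; +_; _+_; _-_; _*_)
  open import Data.Integer.Properties using (pos-+; pos-*)
  open import Data.Integer.Divisibility.Signed renaming (_∣_ to _∣ℤ_) using ()
  open import Data.Integer.Tactic.RingSolver using (solve-∀)
  import Data.Nat.Tactic.RingSolver as ℕ-Solver
  open import Data.Empty using (⊥-elim)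
  open import Data.Sum using (inj₁; inj₂)
  open import Relation.Binary.PropositionalEquality

  module _ (p : ℕ) where

    ^-∣Δ-* : ∀ {f g} → (p ℕ.^_) ∣Δ f → (p ℕ.^_) ∣Δ g → (p ℕ.^_) ∣Δ (λ k → f k * g k)
    ^-∣Δ-* = ∣Δ-* (λ j l → ∣-reflexive (ℕ.^-distribˡ-+-* p j l))

    linear-∣Δ : ∀ c → (p ℕ.^_) ∣Δ (λ k → + (k ℕ.* p ℕ.+ c))
    linear-∣Δ c = ∣Δ-degree 2 (λ k → trans (Δ^-cong 1 slope k) (Δ^-const 0 (+ p) k)) low
      where
        slope : ∀ k → Δ (λ k → + (k ℕ.* p ℕ.+ c)) k ≡ + p
        slope k = begin
          + (p ℕ.+ k ℕ.* p ℕ.+ c) - + (k ℕ.* p ℕ.+ c)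
            ≡⟨ cong₂ _-_ (trans (pos-+ (p ℕ.+ k ℕ.* p) c) (cong (_+ + c) (pos-+ p (k ℕ.* p)))) (pos-+ (k ℕ.* p) c) ⟩
          + p + + (k ℕ.* p) + + c - (+ (k ℕ.* p) + + c)
            ≡⟨ cancel (+ p) (+ (k ℕ.* p)) (+ c) ⟩
          + p ∎
          where
            open ≡-Reasoning
            cancel : ∀ a b c → a + b + c - (b + c) ≡ a
            cancel = solve-∀
        low : ∀ i k → i < 2 → + (p ℕ.^ i) ∣ℤ Δ^ i (λ k → + (k ℕ.* p ℕ.+ c)) k
        low zero       k _ = 1∣ℤ _
        low (suc zero) k _ = subst (+ (p ℕ.* 1) ∣ℤ_) (sym (slope k)) (∣-+ (∣-reflexive (ℕ.*-identityʳ p)))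
        low (suc (suc i)) k (s≤s (s≤s ()))

    rising-∣Δ : ∀ c l → (p ℕ.^_) ∣Δ (λ k → + rising (k ℕ.* p ℕ.+ c) l)
    rising-∣Δ c zero    = ∣Δ-degree 1 (Δ^-const 0 (+ 1)) (λ { zero k _ → 1∣ℤ _ ; (suc i) k (s≤s ()) })
    rising-∣Δ c (suc l) = ∣Δ-cong (λ k → sym (factor k)) (^-∣Δ-* (rising-∣Δ c l) (linear-∣Δ (c ℕ.+ suc l)))
      where
        factor : ∀ k → + rising (k ℕ.* p ℕ.+ c) (suc l) ≡ + rising (k ℕ.* p ℕ.+ c) l * + (k ℕ.* p ℕ.+ (c ℕ.+ suc l))
        factor k = trans (cong (λ z → + (rising (k ℕ.* p ℕ.+ c) l ℕ.* z)) (ℕ.+-assoc (k ℕ.* p) c (suc l)))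
                         (pos-* (rising (k ℕ.* p ℕ.+ c) l) _)

    power-∣Δ : ∀ l → (p ℕ.^_) ∣Δ (λ k → + (k ℕ.* p) ℕ.^ l)
    power-∣Δ zero    = ∣Δ-degree 1 (Δ^-const 0 (+ 1)) (λ { zero k _ → 1∣ℤ _ ; (suc i) k (s≤s ()) })
    power-∣Δ (suc l) = ∣Δ-cong factor (^-∣Δ-* (linear-∣Δ 0) (power-∣Δ l))
      where
        factor : ∀ k → + (k ℕ.* p ℕ.+ 0) * + (k ℕ.* p) ℕ.^ l ≡ + (k ℕ.* p) ℕ.^ suc l
        factor k = trans (sym (pos-* (k ℕ.* p ℕ.+ 0) _))
                         (cong (λ z → + (z ℕ.* (k ℕ.* p) ℕ.^ l)) (ℕ.+-identityʳ (k ℕ.* p)))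

    power-∣Δ-constant : ∀ l → (λ _ → p ℕ.^ l) ∣Δ (λ k → + (k ℕ.* p) ℕ.^ l)
    power-∣Δ-constant l = ∣Δ-cong factor
      (∣Δ-weaken (λ _ → ∣-reflexive (sym (ℕ.*-identityʳ (p ℕ.^ l)))) (∣Δ-scale (p ℕ.^ l) 1∣Δ))
      where
        factor : ∀ k → + (p ℕ.^ l) * + (k ℕ.^ l) ≡ + (k ℕ.* p) ℕ.^ l
        factor k = trans (sym (pos-* (p ℕ.^ l) (k ℕ.^ l)))
                         (cong +_ (sym (trans (cong (ℕ._^ l) (ℕ.*-comm k p)) (*-^ p k l))))

    ∣Δ-*-congruence : ∀ {f f′ g g′ : Seq} → (p ℕ.^_) ∣Δ f′ → (p ℕ.^_) ∣Δ g →
      (λ i → p ℕ.^ suc i) ∣Δ (λ k → f k - f′ k) → (λ i → p ℕ.^ suc i) ∣Δ (λ k → g k - g′ k) →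
      (λ i → p ℕ.^ suc i) ∣Δ (λ k → f k * g k - f′ k * g′ k)
    ∣Δ-*-congruence {f} {f′} {g} {g′} f′∣ g∣ f≡f′ g≡g′ = ∣Δ-cong (λ k → regroup (f k) (f′ k) (g k) (g′ k))
      (∣Δ-+ (∣Δ-* {f = λ k → f k - f′ k} {g} (λ j l → ∣-reflexive (first j l)) f≡f′ g∣)
            (∣Δ-* {f = f′} {λ k → g k - g′ k} (λ j l → ∣-reflexive (second j l)) f′∣ g≡g′))
      where
        regroup : ∀ a b c d → (a - b) * c + b * (c - d) ≡ a * c - b * d
        regroup = solve-∀
        first : ∀ j l → p ℕ.^ suc (j ℕ.+ l) ≡ p ℕ.^ suc j ℕ.* p ℕ.^ l
        first j l = trans (cong (p ℕ.*_) (ℕ.^-distribˡ-+-* p j l)) (sym (ℕ.*-assoc p _ _))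
        second : ∀ j l → p ℕ.^ suc (j ℕ.+ l) ≡ p ℕ.^ j ℕ.* p ℕ.^ suc l
        second j l = trans (cong (p ℕ.^_) (sym (ℕ.+-suc j l))) (ℕ.^-distribˡ-+-* p j (suc l))

  module _ {N : ℕ} (p-prime : Prime (suc N)) where

    private
      p = suc N

    nonMultiples-suc-≤-⊔ : ∀ i → nonMultiples p (suc i) ≤ i ℕ.⊔ N
    nonMultiples-suc-≤-⊔ i with ℕ.<-≤-connex i N
    ... | inj₁ i<N = ℕ.≤-trans (nonMultiples-≤ p (suc i)) (ℕ.≤-trans i<N (ℕ.m≤n⊔m i N))
    ... | inj₂ N≤i = ℕ.≤-trans (nonMultiples-≤-pred p (s≤s N≤i)) (ℕ.m≤m⊔n i N)

    middleTerm-∣Δ : ∀ l → 0 < l → l < N →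
      (λ i → p ℕ.^ nonMultiples p (suc i)) ∣Δ (λ k → + (stirling N l ℕ.* (k ℕ.* p) ℕ.^ l))
    middleTerm-∣Δ l 0<l l<N with stirling-∣ p-prime l 0<l l<N
    ... | divides q c≡qp = ∣Δ-cong (λ k → sym (factor k))
      (∣Δ-weaken (λ i → ^-monoʳ-∣ p (nonMultiples-≤ p (suc i))) (∣Δ-*ˡ (+ q) (∣Δ-scale p (power-∣Δ p l))))
      where
        factor : ∀ k → + (stirling N l ℕ.* (k ℕ.* p) ℕ.^ l) ≡ + q * (+ p * + (k ℕ.* p) ℕ.^ l)
        factor k = begin
          + (stirling N l ℕ.* (k ℕ.* p) ℕ.^ l) ≡⟨ cong (λ c → + (c ℕ.* (k ℕ.* p) ℕ.^ l)) c≡qp ⟩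
          + (q ℕ.* p ℕ.* (k ℕ.* p) ℕ.^ l)     ≡⟨ cong +_ (ℕ.*-assoc q p _) ⟩
          + (q ℕ.* (p ℕ.* (k ℕ.* p) ℕ.^ l))   ≡⟨ trans (pos-* q _) (cong (+ q *_) (pos-* p _)) ⟩
          + q * (+ p * + (k ℕ.* p) ℕ.^ l)     ∎
          where open ≡-Reasoning

    topTerm-∣Δ : (λ i → p ℕ.^ nonMultiples p (suc i)) ∣Δ (λ k → + (stirling N N ℕ.* (k ℕ.* p) ℕ.^ N))
    topTerm-∣Δ = ∣Δ-cong (λ k → cong +_ (sym (trans (cong (ℕ._* (k ℕ.* p) ℕ.^ N) (stirling-diagonal N)) (ℕ.*-identityˡ _))))
      (∣Δ-weaken (λ i → ^-monoʳ-∣ p (nonMultiples-suc-≤-⊔ i))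
        (∣Δ-^-⊔ p {ε = λ i → i} {δ = λ _ → N} (power-∣Δ p N) (power-∣Δ-constant p N)))

    1+rising-∣Δ : (λ i → p ℕ.^ nonMultiples p (suc i)) ∣Δ (λ k → + (1 ℕ.+ rising (k ℕ.* p) N))
    1+rising-∣Δ = ∣Δ-cong (λ k → sym (expansion k))
      (∣Δ-+ (∣Δ-degree 1 (Δ^-const 0 (+ (1 ℕ.+ c 0 ℕ.* 1))) constantTerm) (∣Δ-sumTo N′ _ term))
      where
        c = stirling N
        N′ = N ℕ.∸ 1
        N≡1+N′ : N ≡ suc N′
        N≡1+N′ = sym (ℕ.m+[n∸m]≡n (ℕ.≤-pred (ℕ.nonTrivial⇒n>1 p {{prime⇒nonTrivial p-prime}})))
        expansion : ∀ k → + (1 ℕ.+ rising (k ℕ.* p) N) ≡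
                    + (1 ℕ.+ c 0 ℕ.* 1) + + sumTo N′ (λ j → c (suc j) ℕ.* (k ℕ.* p) ℕ.^ suc j)
        expansion k = begin
          + (1 ℕ.+ rising (k ℕ.* p) N)
            ≡⟨ cong (λ x → + (1 ℕ.+ x)) (trans (rising-expansion (k ℕ.* p) N)
                                               (cong (λ z → sumTo z (λ l → c l ℕ.* (k ℕ.* p) ℕ.^ l)) N≡1+N′)) ⟩
          + (1 ℕ.+ sumTo (suc N′) (λ l → c l ℕ.* (k ℕ.* p) ℕ.^ l))
            ≡⟨ cong (λ x → + (1 ℕ.+ x)) (sumTo-suc N′ _) ⟩
          + (1 ℕ.+ (c 0 ℕ.* 1 ℕ.+ sumTo N′ (λ j → c (suc j) ℕ.* (k ℕ.* p) ℕ.^ suc j)))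
            ≡⟨ trans (cong +_ (sym (ℕ.+-assoc 1 (c 0 ℕ.* 1) _))) (pos-+ (1 ℕ.+ c 0 ℕ.* 1) _) ⟩
          + (1 ℕ.+ c 0 ℕ.* 1) + + sumTo N′ (λ j → c (suc j) ℕ.* (k ℕ.* p) ℕ.^ suc j) ∎
          where open ≡-Reasoning
        p∣1+c₀ : p ∣ 1 ℕ.+ c 0 ℕ.* 1
        p∣1+c₀ = subst (p ∣_) (trans (ℕ.+-comm (N ℕ.!) 1) (cong (1 ℕ.+_) (sym (trans (ℕ.*-identityʳ (c 0)) (stirling-zero N)))))
                       (wilson p-prime)
        constantTerm : ∀ i k → i < 1 → + (p ℕ.^ nonMultiples p (suc i)) ∣ℤ Δ^ i (λ _ → + (1 ℕ.+ c 0 ℕ.* 1)) k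
        constantTerm zero k _ =
          ∣-+ (∣-trans (^-monoʳ-∣ p (nonMultiples-≤ p 1)) (∣-trans (∣-reflexive (ℕ.*-identityʳ p)) p∣1+c₀))
        constantTerm (suc i) k (s≤s ())
        term : ∀ j → j ≤ N′ →
               (λ i → p ℕ.^ nonMultiples p (suc i)) ∣Δ (λ k → + (c (suc j) ℕ.* (k ℕ.* p) ℕ.^ suc j))
        term j j≤N′ with ℕ.m≤n⇒m<n∨m≡n (ℕ.≤-trans (s≤s j≤N′) (ℕ.≤-reflexive (sym N≡1+N′)))
        ... | inj₁ 1+j<N = middleTerm-∣Δ (suc j) (s≤s z≤n) 1+j<N
        ... | inj₂ 1+j≡N =
          subst (λ l → (λ i → p ℕ.^ nonMultiples p (suc i)) ∣Δ (λ k → + (c l ℕ.* (k ℕ.* p) ℕ.^ l))) (sym 1+j≡N) topTerm-∣Δ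

  module _ (N n : ℕ) where

    open Blocks N n

    private
      A B : ℕ → ℤ
      A k = + rising (k ℕ.* p ℕ.+ s) (N ℕ.∸ s)
      B k = + rising (k ℕ.* p ℕ.+ 0) s

    blockUnits-split : ∀ k → + blockUnits k ≡ A (k ℕ.+ m) * B (k ℕ.+ suc m)
    blockUnits-split k = trans (cong₂ (λ x y → + (rising x (N ℕ.∸ s) ℕ.* rising y s)) first second)
                               (pos-* (rising ((k ℕ.+ m) ℕ.* p ℕ.+ s) (N ℕ.∸ s)) _)
      where
        first : k ℕ.* p ℕ.+ n ≡ (k ℕ.+ m) ℕ.* p ℕ.+ s
        first = trans (cong (k ℕ.* p ℕ.+_) n≡m*p+s) (regroup k m p s)
          where regroup : ∀ k m p s → k ℕ.* p ℕ.+ (m ℕ.* p ℕ.+ s) ≡ (k ℕ.+ m) ℕ.* p ℕ.+ s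
                regroup = ℕ-Solver.solve-∀
        second : k ℕ.* p ℕ.+ suc m ℕ.* p ≡ (k ℕ.+ suc m) ℕ.* p ℕ.+ 0
        second = regroup k m p
          where regroup : ∀ k m p → k ℕ.* p ℕ.+ suc m ℕ.* p ≡ (k ℕ.+ suc m) ℕ.* p ℕ.+ 0
                regroup = ℕ-Solver.solve-∀

    rising-split : ∀ k → + rising (k ℕ.* p) N ≡ A k * B k
    rising-split k = begin
      + rising (k ℕ.* p) N
        ≡⟨ cong₂ (λ x l → + rising x l) (sym (ℕ.+-identityʳ (k ℕ.* p))) (sym (ℕ.m+[n∸m]≡n s≤N)) ⟩
      + rising (k ℕ.* p ℕ.+ 0) (s ℕ.+ (N ℕ.∸ s))
        ≡⟨ cong +_ (rising-+ (k ℕ.* p ℕ.+ 0) s (N ℕ.∸ s)) ⟩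
      + (rising (k ℕ.* p ℕ.+ 0) s ℕ.* rising (k ℕ.* p ℕ.+ 0 ℕ.+ s) (N ℕ.∸ s))
        ≡⟨ cong (λ x → + (rising (k ℕ.* p ℕ.+ 0) s ℕ.* rising (x ℕ.+ s) (N ℕ.∸ s))) (ℕ.+-identityʳ (k ℕ.* p)) ⟩
      + (rising (k ℕ.* p ℕ.+ 0) s ℕ.* rising (k ℕ.* p ℕ.+ s) (N ℕ.∸ s))
        ≡⟨ trans (cong +_ (ℕ.*-comm (rising (k ℕ.* p ℕ.+ 0) s) _)) (pos-* (rising (k ℕ.* p ℕ.+ s) (N ℕ.∸ s)) _) ⟩
      A k * B k ∎
      where open ≡-Reasoning

    -- W(k) = A(k+m) B(k+m+1) and rising (kp) N = A(k) B(k); shifting the argument of a sequence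
    -- whose i-th differences are divisible by p^i changes it by one whose i-th differences are
    -- divisible by p^(i+1).
    blockUnits-≡-rising : (λ i → p ℕ.^ suc i) ∣Δ (λ k → + blockUnits k - + rising (k ℕ.* p) N)
    blockUnits-≡-rising =
      ∣Δ-cong (λ k → sym (cong₂ _-_ (blockUnits-split k) (rising-split k)))
        (∣Δ-*-congruence p {f = λ k → A (k ℕ.+ m)} {A} {λ k → B (k ℕ.+ suc m)} {B}
          (rising-∣Δ p s (N ℕ.∸ s)) (∣Δ-shiftBy (suc m) (rising-∣Δ p 0 s))
          (∣Δ-shift-difference m (rising-∣Δ p s (N ℕ.∸ s))) (∣Δ-shift-difference (suc m) (rising-∣Δ p 0 s)))

    1+blockUnits-∣Δ : Prime p → (λ i → p ℕ.^ nonMultiples p (suc i)) ∣Δ (λ k → + (1 ℕ.+ blockUnits k))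
    1+blockUnits-∣Δ p-prime = ∣Δ-cong regroup
      (∣Δ-+ (1+rising-∣Δ p-prime) (∣Δ-weaken (λ i → ^-monoʳ-∣ p (nonMultiples-≤ p (suc i))) blockUnits-≡-rising))
      where
        regroup : ∀ k → + (1 ℕ.+ rising (k ℕ.* p) N) + (+ blockUnits k - + rising (k ℕ.* p) N) ≡ + (1 ℕ.+ blockUnits k)
        regroup k = trans (cong (_+ (+ blockUnits k - + rising (k ℕ.* p) N)) (pos-+ 1 _))
          (trans (cancel (+ 1) (+ rising (k ℕ.* p) N) (+ blockUnits k)) (sym (pos-+ 1 (blockUnits k))))
          where cancel : ∀ a q w → a + q + (w - q) ≡ a + w
                cancel = solve-∀

open NonMultiples
open WeightedShifts
open FactorialBlocks
open BlockUnits
open Arithmetic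
open import Data.Nat as ℕ using (zero; suc; _+_; _∸_; _/_; _≤_; _≤?_; NonZero)
import Data.Nat.Properties as ℕ
open import Data.Nat.DivMod using (m/n≤m)
open import Data.Nat.Divisibility using (module ∣-Reasoning; *-pres-∣; ∣m⇒∣m*n)
open import Data.Nat.Combinatorics using (_C_)
open import Data.Product using (_,_)
open import Data.Empty using (⊥-elim)
open import Relation.Nullary using (yes; no)
open import Relation.Binary.PropositionalEquality using (trans)

M≤o+nonMultiples : ∀ p .{{_ : NonZero p}} a n o → M p a n o ≤ o + nonMultiples p (a ∸ n / p)
M≤o+nonMultiples p a n o with a ℕ.* p ≤? n
... | yes _ = ℕ.m≤m+n o _
... | no  _ = ℕ.≤-reflexive (trans (ℕ.+-∸-comm o (m/n≤m t p)) (ℕ.+-comm (nonMultiples p t) o))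
  where t = a ∸ n / p

lemma3p2p1 : (p : ℕ) → (pp : Prime p) → ¬ (2 ∣ p) → (a q n o : ℕ) →
    IsOrd p (n !) o →
    p ^ M p a n o {{prime⇒nonZero pp}} ∣ S p a q n {{prime⇒nonZero pp}}
lemma3p2p1 zero    pp _ a q n o _ = ⊥-elim (ℕ.NonZero.nonZero (prime⇒nonZero pp))
lemma3p2p1 (suc N) pp _ a q n o (p^o∣n! , _) = begin
  p ^ M p a n o                                    ∣⟨ ^-monoʳ-∣ p (M≤o+nonMultiples p a n o) ⟩
  p ^ (o + nonMultiples p (a ∸ m))                 ≡⟨ ℕ.^-distribˡ-+-* p o _ ⟩
  p ^ o ℕ.* p ^ nonMultiples p (a ∸ m)             ∣⟨ *-pres-∣ p^o∣n! (∣m⇒∣m*n (V q) weightedSum∣) ⟩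
  n ! ℕ.* (weightedStep^ blockUnits a B q ℕ.* V q) ≡⟨ S-decomposition a q ⟨
  S p a q n                                        ∎
  where
    open ∣-Reasoning
    open Blocks N n
    B = λ k → (k + m) C m
    weightedSum∣ : p ^ nonMultiples p (a ∸ m) ∣ weightedStep^ blockUnits a B q
    weightedSum∣ = weightedStep^-∣ p (1+blockUnits-∣Δ N n pp) m a (binomial-∣Δ p m) q
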